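{- Let $p$ be a prime, let $m$ be an integer with $2 \le m \le p-1$, let $b \in \mathbb{F}_{p^2}$ satisfy $b^{p+1}=1$ (equivalently $b=r^{p-1}$ for some $r\in\mathbb{F}_{p^2}^*$), and let $\alpha,\beta\in\mathbb{F}_{p^2}^*$ satisfy $\alpha^{p+1}\neq\beta^{p+1}$ and $$(\beta+b\alpha)^{p-1}=(-1)^m b^{mp-1}.$$ Define $$\gamma=\frac{ -\alpha}{\beta^{p+1}-\alpha^{p+1}},\quad \epsilon=\frac{\beta^p}{\beta^{p+1}-\alpha^{p+1}},\quad d=(-1)^m b^{mp},\quad \delta=\frac{ -\gamma d-\epsilon}{(\beta^p-\alpha d)^m}.$$ Then the polynomial $$f(x)=(x^p-bx)^m+\alpha x^p+\beta x\in\mathbb{F}_{p^2}[x]$$ is a permutation polynomial of $\mathbb{F}_{p^2}$, and its compositional inverse is $$h(x)=\delta(x^p-dx)^m+\gamma x^p+\epsilon x,$$ i.e. $h(f(c))=c$ and $f(h(c))=c$ for all $c\in\mathbb{F}_{p^2}$.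
   Context: A permutation polynomial of a finite field $\mathbb{F}_q$ is a polynomial $f\in\mathbb{F}_q[x]$ whose evaluation map $\mathbb{F}_q\to\mathbb{F}_q$ is a bijection; its compositional inverse is a polynomial inducing the inverse map (polynomials are considered modulo $x^q-x$, i.e. as functions on $\mathbb{F}_q$). -}

module Defs where

open import Level using (_⊔_)
open import Algebra.Bundles using (CommutativeRing; Semiring)
import Algebra.Definitions.RawSemiring as RawSemiringDefs
open import Data.Nat as ℕ using (ℕ)
open import Data.Fin using (Fin)
open import Data.Product using (Σ; ∃; _×_)
open import Relation.Nullary using (¬_)
open import Relation.Binary.PropositionalEquality using (_≡_)

-- The inverse is a total operation _⁻¹ (its value at 0 is unconstrained).
record IsField {c ℓ} (R : CommutativeRing c ℓ) : Set (c ⊔ ℓ) where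
  open CommutativeRing R
  field
    1≉0       : ¬ (1# ≈ 0#)
    _⁻¹       : Carrier → Carrier
    ⁻¹-cong   : ∀ {x y} → x ≈ y → x ⁻¹ ≈ y ⁻¹
    *-inverse : ∀ x → ¬ (x ≈ 0#) → x * (x ⁻¹) ≈ 1#

HasCardinality : ∀ {c ℓ} (R : CommutativeRing c ℓ) → ℕ → Set (c ⊔ ℓ)
HasCardinality R n =
  Σ (Fin n → Carrier) λ e →
    (∀ x → ∃ λ i → e i ≈ x) × (∀ i j → e i ≈ e j → i ≡ j)
  where open CommutativeRing R

module Theorem3Data {c ℓ} (F : CommutativeRing c ℓ) (FF : IsField F)
                    (p m : ℕ) (b α β : CommutativeRing.Carrier F) where
  open CommutativeRing F
  open IsField FF
  open RawSemiringDefs (Semiring.rawSemiring semiring) public using (_^_)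

  _÷_ : Carrier → Carrier → Carrier
  x ÷ y = x * (y ⁻¹)

  Δ : Carrier
  Δ = (β ^ (p ℕ.+ 1)) - (α ^ (p ℕ.+ 1))

  γ : Carrier
  γ = (- α) ÷ Δ

  ε : Carrier
  ε = (β ^ p) ÷ Δ

  d : Carrier
  d = ((- 1#) ^ m) * (b ^ (m ℕ.* p))

  δ : Carrier
  δ = ((- (γ * d)) - ε) ÷ (((β ^ p) - (α * d)) ^ m)

  f : Carrier → Carrier
  f x = (((x ^ p) - (b * x)) ^ m) + (α * (x ^ p)) + (β * x)

  h : Carrier → Carrier
  h x = (δ * (((x ^ p) - (d * x)) ^ m)) + (γ * (x ^ p)) + (ε * x)

{-# OPTIONS --safe #-}
-- Write x̄ = x ^ p. On the field with p² elements x ↦ x̄ is an involutive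
-- automorphism (p · 1 = 0 and x ^ (p²) = x follow from the fact that translating,
-- resp. multiplying by a unit, permutes the elements), and b̄ b = b ^ (p + 1) = 1. Hence
-- u = x̄ - b x satisfies ū = - b̄ u, so ū ^ m = d u ^ m, and for y = f x
--   ȳ - d y = K u,   K = β̄ - α d,
-- because the hypothesis on (β + b α) ^ (p - 1) says exactly b β̄ + ᾱ = d (β + b α),
-- which kills the x-term. K ≠ 0 since α ^ (p + 1) ≠ β ^ (p + 1). So y determines
-- u ^ m = (ȳ - d y) ^ m / K ^ m, and then x from the linear system
-- y = u ^ m + α x̄ + β x, ȳ = d u ^ m + ᾱ x + β̄ x̄ of determinant β̄ β - ᾱ α ≠ 0;
-- solving it is h. Being a left inverse on a finite set, h is also a right inverse.
module Submission where

open import Defs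
open import Algebra.Bundles using (CommutativeMonoid; CommutativeRing; Semiring)
import Algebra.Definitions.RawSemiring as RawSemiringDefs
open import Data.Fin using (Fin; zero; suc; punchIn; punchOut; toℕ; inject₁; fromℕ)
import Data.Fin.Properties as Finₚ
open import Data.Fin.Permutation using (Permutation; permutation)
open import Data.Nat as ℕ using (ℕ; zero; suc; _∸_; _<_; _≤_; z<s; s<s)
import Data.Nat.Properties as ℕₚ
open import Data.Nat.Combinatorics using (_C_; nCn≡1; nC1≡n; nCk+nC[k+1]≡[n+1]C[k+1])
open import Data.Nat.Divisibility using (_∣_; divides; ∣⇒≤)
open import Data.Nat.Primality using (Prime; euclidsLemma)
open import Data.Product using (∃; _,_; proj₁; proj₂)
open import Data.Sum using (inj₁; inj₂)
open import Function using (id; _∘_; Injective; StrictlySurjective)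
open import Relation.Binary using (Decidable)
open import Relation.Binary.PropositionalEquality as ≡ using (_≡_; _≢_)
open import Relation.Nullary using (¬_; yes; no; contradiction)
import Relation.Nullary.Decidable as Dec

injective⇒strictlySurjective : ∀ {n} {f : Fin n → Fin n} →
                               Injective _≡_ _≡_ f → StrictlySurjective _≡_ f
injective⇒strictlySurjective {suc n} {f} f-injective j with Finₚ.any? (λ i → f i Finₚ.≟ j)
... | yes hit = hit
... | no miss = contradiction (Finₚ.injective⇒≤ avoid-j-injective) ℕₚ.1+n≰n
  where
  j≢f : ∀ i → j ≢ f i
  j≢f i j≡fi = miss (i , ≡.sym j≡fi)

  avoid-j : Fin (suc n) → Fin n
  avoid-j i = punchOut (j≢f i)

  avoid-j-injective : Injective _≡_ _≡_ avoid-j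
  avoid-j-injective eq = f-injective (Finₚ.punchOut-injective (j≢f _) (j≢f _) eq)

injective⇒permutation : ∀ {n} {f : Fin n → Fin n} → Injective _≡_ _≡_ f → Permutation n n
injective⇒permutation {f = f} f-injective = permutation f f⁻¹ f∘f⁻¹ f⁻¹∘f
  where
  f⁻¹ : Fin _ → Fin _
  f⁻¹ j = proj₁ (injective⇒strictlySurjective f-injective j)

  f∘f⁻¹ : ∀ j → f (f⁻¹ j) ≡ j
  f∘f⁻¹ j = proj₂ (injective⇒strictlySurjective f-injective j)

  f⁻¹∘f : ∀ i → f⁻¹ (f i) ≡ i
  f⁻¹∘f i = f-injective (f∘f⁻¹ (f i))

module _ {a ℓ} (M : CommutativeMonoid a ℓ) where
  open CommutativeMonoid M
  open import Algebra.Properties.CommutativeMonoid.Sum M using (sum; sum-permute; sum-cong-≋)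
  open import Relation.Binary.Reasoning.Setoid setoid

  sum-reindex : ∀ {k} (u : Fin k → Carrier) → Injective _≡_ _≈_ u →
                (φ : Carrier → Carrier) → Injective _≈_ _≈_ φ →
                (∀ i → ∃ λ j → u j ≈ φ (u i)) → sum (φ ∘ u) ≈ sum u
  sum-reindex u u-injective φ φ-injective closed = begin
    sum (φ ∘ u) ≈⟨ sum-cong-≋ (λ i → sym (proj₂ (closed i))) ⟩
    sum (u ∘ σ) ≈⟨ sum-permute u (injective⇒permutation σ-injective) ⟨
    sum u       ∎
    where
    σ : Fin _ → Fin _
    σ i = proj₁ (closed i)

    σ-injective : Injective _≡_ _≡_ σ
    σ-injective {i} {j} σi≡σj = u-injective (φ-injective (begin
      φ (u i) ≈⟨ proj₂ (closed i) ⟨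
      u (σ i) ≡⟨ ≡.cong u σi≡σj ⟩
      u (σ j) ≈⟨ proj₂ (closed j) ⟩
      φ (u j) ∎))

module IntegerCoefficientSolver {c ℓ} (R : CommutativeRing c ℓ) where
  open CommutativeRing R hiding (zero)
  open import Algebra.Definitions.RawSemiring (Semiring.rawSemiring semiring) using (_×_)
  open import Data.Integer as ℤ using (ℤ; +_; -[1+_]; _⊖_; _◃_; sign; ∣_∣)
  import Data.Integer.Properties as ℤₚ
  open import Data.Maybe using (Maybe; just; nothing)
  open import Data.Sign as Sign using (Sign)
  open import Algebra.Properties.Monoid.Mult +-monoid using (×-homo-+)
  open import Algebra.Properties.Semiring.Mult semiring using (×1-homo-*)
  open import Algebra.Properties.Ring ring using (-‿distribˡ-*; -‿distribʳ-*; -0#≈0#; -‿involutive)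
  open import Algebra.Properties.AbelianGroup +-abelianGroup using (⁻¹-∙-comm)
  open import Algebra.Properties.CommutativeSemigroup +-commutativeSemigroup using (interchange)
  open import Algebra.Solver.Ring.AlmostCommutativeRing using (fromCommutativeRing; _-Raw-AlmostCommutative⟶_)
  open import Relation.Binary.Reasoning.Setoid setoid

  fromℤ : ℤ → Carrier
  fromℤ (+ n)    = n × 1#
  fromℤ -[1+ n ] = - (suc n × 1#)

  fromℤ-⊖ : ∀ m n → fromℤ (m ⊖ n) ≈ m × 1# - n × 1#
  fromℤ-⊖ zero    zero    = sym (-‿inverseʳ 0#)
  fromℤ-⊖ zero    (suc n) = sym (+-identityˡ _)
  fromℤ-⊖ (suc m) zero    = sym (trans (+-congˡ -0#≈0#) (+-identityʳ _))
  fromℤ-⊖ (suc m) (suc n) = begin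
    fromℤ (suc m ⊖ suc n)                 ≡⟨ ≡.cong fromℤ (ℤₚ.[1+m]⊖[1+n]≡m⊖n m n) ⟩
    fromℤ (m ⊖ n)                         ≈⟨ fromℤ-⊖ m n ⟩
    m × 1# - n × 1#                       ≈⟨ +-identityˡ _ ⟨
    0# + (m × 1# - n × 1#)                ≈⟨ +-congʳ (-‿inverseʳ 1#) ⟨
    (1# - 1#) + (m × 1# - n × 1#)         ≈⟨ interchange 1# (- 1#) (m × 1#) (- (n × 1#)) ⟩
    (1# + m × 1#) + (- 1# - n × 1#)       ≈⟨ +-congˡ (⁻¹-∙-comm 1# (n × 1#)) ⟩
    (1# + m × 1#) - (1# + n × 1#)         ∎

  fromℤ-homo-+ : ∀ i j → fromℤ (i ℤ.+ j) ≈ fromℤ i + fromℤ j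
  fromℤ-homo-+ (+ m)    (+ n)    = ×-homo-+ 1# m n
  fromℤ-homo-+ (+ m)    -[1+ n ] = fromℤ-⊖ m (suc n)
  fromℤ-homo-+ -[1+ m ] (+ n)    = trans (fromℤ-⊖ n (suc m)) (+-comm _ _)
  fromℤ-homo-+ -[1+ m ] -[1+ n ] = begin
    - (suc (suc (m ℕ.+ n)) × 1#)          ≡⟨ ≡.cong (λ k → - (k × 1#)) (ℕₚ.+-suc (suc m) n) ⟨
    - ((suc m ℕ.+ suc n) × 1#)            ≈⟨ -‿cong (×-homo-+ 1# (suc m) (suc n)) ⟩
    - (suc m × 1# + suc n × 1#)           ≈⟨ ⁻¹-∙-comm _ _ ⟨
    - (suc m × 1#) - suc n × 1#           ∎

  signed : Sign → Carrier → Carrier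
  signed Sign.+ x = x
  signed Sign.- x = - x

  signed-cong : ∀ s {x y} → x ≈ y → signed s x ≈ signed s y
  signed-cong Sign.+ = id
  signed-cong Sign.- = -‿cong

  signed-* : ∀ s t x y → signed (s Sign.* t) (x * y) ≈ signed s x * signed t y
  signed-* Sign.+ Sign.+ x y = refl
  signed-* Sign.+ Sign.- x y = -‿distribʳ-* x y
  signed-* Sign.- Sign.+ x y = -‿distribˡ-* x y
  signed-* Sign.- Sign.- x y = begin
    x * y         ≈⟨ -‿involutive _ ⟨
    - - (x * y)   ≈⟨ -‿cong (-‿distribˡ-* x y) ⟩
    - (- x * y)   ≈⟨ -‿distribʳ-* (- x) y ⟩
    - x * - y     ∎

  fromℤ-◃ : ∀ s n → fromℤ (s ◃ n) ≈ signed s (n × 1#)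
  fromℤ-◃ Sign.+ zero    = refl
  fromℤ-◃ Sign.- zero    = sym -0#≈0#
  fromℤ-◃ Sign.+ (suc n) = refl
  fromℤ-◃ Sign.- (suc n) = refl

  fromℤ-sign-abs : ∀ i → fromℤ i ≈ signed (sign i) (∣ i ∣ × 1#)
  fromℤ-sign-abs (+ zero)  = refl
  fromℤ-sign-abs (+ suc n) = refl
  fromℤ-sign-abs -[1+ n ]  = refl

  fromℤ-homo-* : ∀ i j → fromℤ (i ℤ.* j) ≈ fromℤ i * fromℤ j
  fromℤ-homo-* i j = begin
    fromℤ (i ℤ.* j)                                ≈⟨ fromℤ-◃ s (∣ i ∣ ℕ.* ∣ j ∣) ⟩
    signed s ((∣ i ∣ ℕ.* ∣ j ∣) × 1#)              ≈⟨ signed-cong s (×1-homo-* ∣ i ∣ ∣ j ∣) ⟩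
    signed s ((∣ i ∣ × 1#) * (∣ j ∣ × 1#))         ≈⟨ signed-* (sign i) (sign j) _ _ ⟩
    signed (sign i) (∣ i ∣ × 1#) * signed (sign j) (∣ j ∣ × 1#)
                                                   ≈⟨ *-cong (fromℤ-sign-abs i) (fromℤ-sign-abs j) ⟨
    fromℤ i * fromℤ j                              ∎
    where s = sign i Sign.* sign j

  fromℤ-homo-‿ : ∀ i → fromℤ (ℤ.- i) ≈ - fromℤ i
  fromℤ-homo-‿ (+ zero)  = sym -0#≈0#
  fromℤ-homo-‿ (+ suc n) = refl
  fromℤ-homo-‿ -[1+ n ]  = sym (-‿involutive _)

  fromℤ-morphism : ℤ.+-*-rawRing -Raw-AlmostCommutative⟶ fromCommutativeRing R
  fromℤ-morphism = record
    { ⟦_⟧    = fromℤ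
    ; +-homo = fromℤ-homo-+
    ; *-homo = fromℤ-homo-*
    ; -‿homo = fromℤ-homo-‿
    ; 0-homo = refl
    ; 1-homo = +-identityʳ 1#
    }

  fromℤ-≟ : ∀ i j → Maybe (fromℤ i ≈ fromℤ j)
  fromℤ-≟ i j with i ℤ.≟ j
  ... | yes ≡.refl = just refl
  ... | no _       = nothing

  open import Algebra.Solver.Ring ℤ.+-*-rawRing (fromCommutativeRing R) fromℤ-morphism fromℤ-≟ public

[1+k]*[1+n]C[1+k]≡[1+n]*nCk : ∀ n k → suc k ℕ.* (suc n C suc k) ≡ suc n ℕ.* (n C k)
[1+k]*[1+n]C[1+k]≡[1+n]*nCk zero    zero    = ≡.refl
[1+k]*[1+n]C[1+k]≡[1+n]*nCk zero    (suc k) = ℕₚ.*-zeroʳ (suc (suc k))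
[1+k]*[1+n]C[1+k]≡[1+n]*nCk (suc n) zero    = begin
  1 ℕ.* (suc (suc n) C 1) ≡⟨ ℕₚ.*-identityˡ _ ⟩
  suc (suc n) C 1         ≡⟨ nC1≡n (suc (suc n)) ⟩
  suc (suc n)             ≡⟨ ℕₚ.*-identityʳ _ ⟨
  suc (suc n) ℕ.* 1       ∎
  where open ≡.≡-Reasoning
[1+k]*[1+n]C[1+k]≡[1+n]*nCk (suc n) (suc k) = begin
  suc (suc k) ℕ.* (suc (suc n) C suc (suc k))
    ≡⟨ ≡.cong (suc (suc k) ℕ.*_) (nCk+nC[k+1]≡[n+1]C[k+1] (suc n) (suc k)) ⟨
  suc (suc k) ℕ.* (A + B)
    ≡⟨ ℕₚ.*-distribˡ-+ (suc (suc k)) A B ⟩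
  (A + suc k ℕ.* A) + suc (suc k) ℕ.* B
    ≡⟨ ≡.cong₂ (λ x y → (A + x) + y) ([1+k]*[1+n]C[1+k]≡[1+n]*nCk n k)
                                       ([1+k]*[1+n]C[1+k]≡[1+n]*nCk n (suc k)) ⟩
  (A + suc n ℕ.* (n C k)) + suc n ℕ.* (n C suc k)
    ≡⟨ ℕₚ.+-assoc A _ _ ⟩
  A + (suc n ℕ.* (n C k) + suc n ℕ.* (n C suc k))
    ≡⟨ ≡.cong (λ x → A + x) (ℕₚ.*-distribˡ-+ (suc n) (n C k) (n C suc k)) ⟨
  A + suc n ℕ.* (n C k + n C suc k)
    ≡⟨ ≡.cong (λ x → A + suc n ℕ.* x) (nCk+nC[k+1]≡[n+1]C[k+1] n k) ⟩
  A + suc n ℕ.* A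
    ∎
  where
  open ≡.≡-Reasoning
  open import Data.Nat using (_+_)

  A B : ℕ
  A = suc n C suc k
  B = suc n C suc (suc k)

prime∣pCk : ∀ {p k} → Prime p → 0 < k → k < p → p ∣ p C k
prime∣pCk {suc n} {suc k} p-prime _ k<p
  with euclidsLemma (suc k) (suc n C suc k) p-prime
         (divides (n C k) (≡.trans ([1+k]*[1+n]C[1+k]≡[1+n]*nCk n k) (ℕₚ.*-comm (suc n) (n C k))))
... | inj₁ p∣1+k = contradiction (∣⇒≤ p∣1+k) (ℕₚ.<⇒≱ k<p)
... | inj₂ p∣pCk = p∣pCk

module Frobenius {c ℓ} (R : CommutativeRing c ℓ) where
  open CommutativeRing R hiding (zero)
  open RawSemiringDefs (Semiring.rawSemiring semiring) using (_^_; _×_)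
  open import Algebra.Properties.Monoid.Mult +-monoid using (×-congʳ)
  open import Algebra.Properties.Semiring.Mult semiring using (×-assoc-*; ×1-homo-*)
  open import Algebra.Properties.Monoid.Sum +-monoid using (sum; sum-init-last; sum-cong-≋; sum-replicate-zero)
  import Algebra.Properties.CommutativeSemiring.Binomial commutativeSemiring as Binomial
  open import Relation.Binary.Reasoning.Setoid setoid

  p∣m⇒m×x≈0 : ∀ {p m} → p × 1# ≈ 0# → p ∣ m → ∀ x → m × x ≈ 0#
  p∣m⇒m×x≈0 {p} p×1≈0 (divides q ≡.refl) x = begin
    (q ℕ.* p) × x                  ≈⟨ ×-congʳ (q ℕ.* p) (*-identityˡ x) ⟨
    (q ℕ.* p) × (1# * x)           ≈⟨ ×-assoc-* (q ℕ.* p) 1# x ⟨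
    ((q ℕ.* p) × 1#) * x           ≈⟨ *-congʳ (×1-homo-* q p) ⟩
    ((q × 1#) * (p × 1#)) * x      ≈⟨ *-congʳ (*-congˡ p×1≈0) ⟩
    ((q × 1#) * 0#) * x            ≈⟨ *-congʳ (zeroʳ _) ⟩
    0# * x                         ≈⟨ zeroˡ x ⟩
    0#                             ∎

  ^p-homo-+ : ∀ {p} → Prime p → p × 1# ≈ 0# → ∀ x y → (x + y) ^ p ≈ x ^ p + y ^ p
  ^p-homo-+ {suc n} p-prime p×1≈0 x y = begin
    (x + y) ^ p                                         ≈⟨ Binomial.theorem p x y ⟩
    t zero + sum (t ∘ suc)                              ≈⟨ +-congˡ (sum-init-last (t ∘ suc)) ⟩
    t zero + (sum (t ∘ suc ∘ inject₁) + t (suc (fromℕ n))) ≈⟨ +-cong first (+-cong inner last) ⟩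
    y ^ p + (0# + x ^ p)                                ≈⟨ +-congˡ (+-identityˡ _) ⟩
    y ^ p + x ^ p                                       ≈⟨ +-comm _ _ ⟩
    x ^ p + y ^ p                                       ∎
    where
    p : ℕ
    p = suc n

    t : Fin (suc p) → Carrier
    t = Binomial.binomialTerm x y p

    first : t zero ≈ y ^ p
    first = trans (+-identityʳ _) (*-identityˡ _)

    last : t (suc (fromℕ n)) ≈ x ^ p
    last rewrite Finₚ.toℕ-fromℕ n | nCn≡1 p | ℕₚ.n∸n≡0 n =
      trans (+-identityʳ _) (*-identityʳ _)

    inner-index<p : ∀ (i : Fin n) → suc (toℕ (inject₁ i)) < p
    inner-index<p i = s<s (≡.subst (_< n) (≡.sym (Finₚ.toℕ-inject₁ i)) (Finₚ.toℕ<n i))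

    inner : sum (t ∘ suc ∘ inject₁) ≈ 0#
    inner = trans (sum-cong-≋ (λ i → p∣m⇒m×x≈0 p×1≈0 (prime∣pCk p-prime z<s (inner-index<p i)) _))
                  (sum-replicate-zero n)

module FieldProperties {c ℓ} {F : CommutativeRing c ℓ} (FF : IsField F) where
  open CommutativeRing F hiding (zero)
  open IsField FF
  open RawSemiringDefs (Semiring.rawSemiring semiring) using (_^_; product)
  open import Relation.Binary.Reasoning.Setoid setoid

  *-inverseˡ : ∀ x → ¬ x ≈ 0# → (x ⁻¹) * x ≈ 1#
  *-inverseˡ x x≉0 = trans (*-comm _ _) (*-inverse x x≉0)

  *-cancelˡ-nonzero : ∀ {x y z} → ¬ x ≈ 0# → x * y ≈ x * z → y ≈ z
  *-cancelˡ-nonzero {x} {y} {z} x≉0 xy≈xz = begin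
    y                ≈⟨ *-identityˡ y ⟨
    1# * y           ≈⟨ *-congʳ (*-inverseˡ x x≉0) ⟨
    ((x ⁻¹) * x) * y ≈⟨ *-assoc _ _ _ ⟩
    (x ⁻¹) * (x * y) ≈⟨ *-congˡ xy≈xz ⟩
    (x ⁻¹) * (x * z) ≈⟨ *-assoc _ _ _ ⟨
    ((x ⁻¹) * x) * z ≈⟨ *-congʳ (*-inverseˡ x x≉0) ⟩
    1# * z           ≈⟨ *-identityˡ z ⟩
    z                ∎

  *-cancelʳ-nonzero : ∀ {x y z} → ¬ z ≈ 0# → x * z ≈ y * z → x ≈ y
  *-cancelʳ-nonzero z≉0 xz≈yz = *-cancelˡ-nonzero z≉0 (trans (*-comm _ _) (trans xz≈yz (*-comm _ _)))

  x*y≈0⇒y≈0 : ∀ {x y} → ¬ x ≈ 0# → x * y ≈ 0# → y ≈ 0#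
  x*y≈0⇒y≈0 {x} x≉0 xy≈0 = *-cancelˡ-nonzero x≉0 (trans xy≈0 (sym (zeroʳ x)))

  *-nonzero : ∀ {x y} → ¬ x ≈ 0# → ¬ y ≈ 0# → ¬ x * y ≈ 0#
  *-nonzero x≉0 y≉0 xy≈0 = y≉0 (x*y≈0⇒y≈0 x≉0 xy≈0)

  ^-nonzero : ∀ {x} n → ¬ x ≈ 0# → ¬ x ^ n ≈ 0#
  ^-nonzero zero    x≉0 = 1≉0
  ^-nonzero (suc n) x≉0 = *-nonzero x≉0 (^-nonzero n x≉0)

  product-nonzero : ∀ {k} (u : Fin k → Carrier) → (∀ i → ¬ u i ≈ 0#) → ¬ product u ≈ 0#
  product-nonzero {zero}  u u≉0 = 1≉0
  product-nonzero {suc k} u u≉0 = *-nonzero (u≉0 zero) (product-nonzero (u ∘ suc) (u≉0 ∘ suc))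

  *⁻¹-cancelʳ : ∀ x {y} → ¬ y ≈ 0# → (x * (y ⁻¹)) * y ≈ x
  *⁻¹-cancelʳ x {y} y≉0 = begin
    (x * (y ⁻¹)) * y ≈⟨ *-assoc x _ y ⟩
    x * ((y ⁻¹) * y) ≈⟨ *-congˡ (*-inverseˡ y y≉0) ⟩
    x * 1#           ≈⟨ *-identityʳ x ⟩
    x                ∎

module FiniteField {c ℓ} {F : CommutativeRing c ℓ} (FF : IsField F)
                   {k} (card : HasCardinality F (suc k)) where
  open CommutativeRing F hiding (zero)
  open IsField FF
  open FieldProperties FF
  open RawSemiringDefs (Semiring.rawSemiring semiring) using (_^_; _×_; product)
  open import Algebra.Properties.CommutativeMonoid.Sum +-commutativeMonoid using (sum; ∑-distrib-+; sum-replicate)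
  open import Algebra.Properties.Group +-group using (identityˡ-unique; ∙-cancelˡ)
  open import Relation.Binary.Reasoning.Setoid setoid

  q : ℕ
  q = suc k

  enum : Fin q → Carrier
  enum = proj₁ card

  index : Carrier → Fin q
  index x = proj₁ (proj₁ (proj₂ card) x)

  enum-index : ∀ x → enum (index x) ≈ x
  enum-index x = proj₂ (proj₁ (proj₂ card) x)

  enum-injective : Injective _≡_ _≈_ enum
  enum-injective = proj₂ (proj₂ card) _ _

  index-cong : ∀ {x y} → x ≈ y → index x ≡ index y
  index-cong {x} {y} x≈y = enum-injective (trans (enum-index x) (trans x≈y (sym (enum-index y))))

  index-injective : Injective _≈_ _≡_ index
  index-injective {x} {y} ix≡iy = trans (sym (enum-index x)) (trans (reflexive (≡.cong enum ix≡iy)) (enum-index y))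

  _≟_ : Decidable _≈_
  x ≟ y = Dec.map′ index-injective index-cong (index x Finₚ.≟ index y)

  characteristic : q × 1# ≈ 0#
  characteristic = identityˡ-unique (q × 1#) (sum enum) (begin
    q × 1# + sum enum             ≈⟨ +-congʳ (sum-replicate q) ⟨
    sum {q} (λ _ → 1#) + sum enum ≈⟨ ∑-distrib-+ (λ _ → 1#) enum ⟨
    sum (λ i → 1# + enum i)       ≈⟨ sum-reindex +-commutativeMonoid enum enum-injective (1# +_)
                                       (∙-cancelˡ 1# _ _) (λ i → index (1# + enum i) , enum-index _) ⟩
    sum enum                      ∎)

  unit : Fin k → Carrier
  unit j = enum (punchIn (index 0#) j)

  unit-nonzero : ∀ j → ¬ unit j ≈ 0#
  unit-nonzero j unit≈0 = Finₚ.punchInᵢ≢i (index 0#) j (enum-injective (trans unit≈0 (sym (enum-index 0#))))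

  unit-injective : Injective _≡_ _≈_ unit
  unit-injective eq = Finₚ.punchIn-injective (index 0#) _ _ (enum-injective eq)

  unit-index : ∀ x → ¬ x ≈ 0# → ∃ λ j → unit j ≈ x
  unit-index x x≉0 = punchOut 0≢x , trans (reflexive (≡.cong enum (Finₚ.punchIn-punchOut 0≢x))) (enum-index x)
    where
    0≢x : index 0# ≢ index x
    0≢x eq = x≉0 (sym (index-injective eq))

  x^[q-1]≈1 : ∀ x → ¬ x ≈ 0# → x ^ k ≈ 1#
  x^[q-1]≈1 x x≉0 = *-cancelʳ-nonzero (product-nonzero unit unit-nonzero) (begin
    x ^ k * product unit                 ≈⟨ *-congʳ (product-replicate k) ⟨
    product {k} (λ _ → x) * product unit ≈⟨ ∑-distrib-* (λ _ → x) unit ⟨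
    product (λ j → x * unit j)           ≈⟨ sum-reindex *-commutativeMonoid unit unit-injective (x *_)
                                              (*-cancelˡ-nonzero x≉0) x*unit∈units ⟩
    product unit                         ≈⟨ *-identityˡ _ ⟨
    1# * product unit                    ∎)
    where
    x*unit∈units : ∀ j → ∃ λ j′ → unit j′ ≈ x * unit j
    x*unit∈units j = unit-index (x * unit j) (*-nonzero x≉0 (unit-nonzero j))

    open import Algebra.Properties.CommutativeMonoid.Sum *-commutativeMonoid
      using () renaming (∑-distrib-+ to ∑-distrib-*; sum-replicate to product-replicate)

  x^q≈x : ∀ x → x ^ q ≈ x
  x^q≈x x with x ≟ 0#
  ... | yes x≈0 = trans (*-congʳ x≈0) (trans (zeroˡ _) (sym x≈0))
  ... | no  x≉0 = trans (*-congˡ (x^[q-1]≈1 x x≉0)) (*-identityʳ x)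

  leftInverse⇒rightInverse : ∀ {f g : Carrier → Carrier} →
                             (∀ {x y} → x ≈ y → f x ≈ f y) → (∀ {x y} → x ≈ y → g x ≈ g y) →
                             (∀ x → g (f x) ≈ x) → ∀ x → f (g x) ≈ x
  leftInverse⇒rightInverse {f} {g} f-cong g-cong g∘f≈id x = begin
    f (g x)             ≈⟨ f-cong (g-cong f[enum-i]≈x) ⟨
    f (g (f (enum i)))  ≈⟨ f-cong (g∘f≈id (enum i)) ⟩
    f (enum i)          ≈⟨ f[enum-i]≈x ⟩
    x                   ∎
    where
    f̂ : Fin q → Fin q
    f̂ i = index (f (enum i))

    f̂-injective : Injective _≡_ _≡_ f̂
    f̂-injective {i} {j} f̂i≡f̂j = enum-injective (begin
      enum i              ≈⟨ g∘f≈id (enum i) ⟨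
      g (f (enum i))      ≈⟨ g-cong (index-injective f̂i≡f̂j) ⟩
      g (f (enum j))      ≈⟨ g∘f≈id (enum j) ⟩
      enum j              ∎)

    i : Fin q
    i = proj₁ (injective⇒strictlySurjective f̂-injective (index x))

    f[enum-i]≈x : f (enum i) ≈ x
    f[enum-i]≈x = index-injective (proj₂ (injective⇒strictlySurjective f̂-injective (index x)))

module Conjugation {c ℓ} {F : CommutativeRing c ℓ} (FF : IsField F)
                   {n} (p-prime : Prime (suc n)) (card : HasCardinality F (suc n ℕ.* suc n)) where
  open CommutativeRing F hiding (zero)
  open RawSemiringDefs (Semiring.rawSemiring semiring) using (_^_; _×_)
  open import Algebra.Properties.Semiring.Exp semiring using (^-congˡ; ^-congʳ; ^-assocʳ; ^-homo-*)
  open import Algebra.Properties.CommutativeSemiring.Exp commutativeSemiring using (^-distrib-*)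
  open import Algebra.Properties.Semiring.Mult semiring using (×1-homo-*)
  open import Algebra.Properties.Group +-group using (inverseʳ-unique)
  open import Relation.Binary.Reasoning.Setoid setoid
  open FieldProperties FF using (x*y≈0⇒y≈0)
  open FiniteField FF card using (_≟_; x^q≈x) renaming (characteristic to p²×1≈0)
  open Frobenius F using (^p-homo-+)

  p : ℕ
  p = suc n

  characteristic : p × 1# ≈ 0#
  characteristic with (p × 1#) ≟ 0#
  ... | yes p×1≈0 = p×1≈0
  ... | no  p×1≉0 = contradiction (x*y≈0⇒y≈0 p×1≉0 (trans (sym (×1-homo-* p p)) p²×1≈0)) p×1≉0

  conj : Carrier → Carrier
  conj x = x ^ p

  conj-cong : ∀ {x y} → x ≈ y → conj x ≈ conj y
  conj-cong = ^-congˡ p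

  conj-homo-+ : ∀ x y → conj (x + y) ≈ conj x + conj y
  conj-homo-+ = ^p-homo-+ p-prime characteristic

  conj-homo-* : ∀ x y → conj (x * y) ≈ conj x * conj y
  conj-homo-* x y = ^-distrib-* x y p

  conj-homo-‿ : ∀ x → conj (- x) ≈ - conj x
  conj-homo-‿ x = inverseʳ-unique (conj x) (conj (- x)) (begin
    conj x + conj (- x) ≈⟨ conj-homo-+ x (- x) ⟨
    conj (x - x)        ≈⟨ conj-cong (-‿inverseʳ x) ⟩
    conj 0#             ≈⟨ zeroˡ _ ⟩
    0#                  ∎)

  conj-homo-‿- : ∀ x y → conj (x - y) ≈ conj x - conj y
  conj-homo-‿- x y = trans (conj-homo-+ x (- y)) (+-congˡ (conj-homo-‿ y))

  conj-homo-^ : ∀ x k → conj (x ^ k) ≈ conj x ^ k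
  conj-homo-^ x k = begin
    (x ^ k) ^ p   ≈⟨ ^-assocʳ x k p ⟩
    x ^ (k ℕ.* p) ≈⟨ ^-congʳ x (ℕₚ.*-comm k p) ⟩
    x ^ (p ℕ.* k) ≈⟨ ^-assocʳ x p k ⟨
    (x ^ p) ^ k   ∎

  conj-involutive : ∀ x → conj (conj x) ≈ x
  conj-involutive x = trans (^-assocʳ x p p) (x^q≈x x)

  x^[p+1]≈conj[x]*x : ∀ x → x ^ (p ℕ.+ 1) ≈ conj x * x
  x^[p+1]≈conj[x]*x x = trans (^-homo-* x p 1) (*-congˡ (*-identityʳ x))

module Theorem3Proof {c ℓ} {F : CommutativeRing c ℓ} (FF : IsField F)
                     {n} (p-prime : Prime (suc n)) (card : HasCardinality F (suc n ℕ.* suc n))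
                     (m′ : ℕ) (b α β : CommutativeRing.Carrier F) where
  open CommutativeRing F hiding (zero)
  open IsField FF
  open RawSemiringDefs (Semiring.rawSemiring semiring) using (_^_)
  open import Algebra.Properties.Semiring.Exp semiring using (^-congˡ; ^-congʳ; ^-assocʳ)
  open import Algebra.Properties.CommutativeSemiring.Exp commutativeSemiring using (^-distrib-*)
  open import Algebra.Properties.Ring ring using (-1*x≈-x)
  open import Algebra.Properties.Group +-group using (x∙y⁻¹≈ε⇒x≈y; x≈y⇒x∙y⁻¹≈ε; ∙-cancelˡ)
  open import Relation.Binary.Reasoning.Setoid setoid
  open IntegerCoefficientSolver F using (solve; _:=_; _:+_; _:*_; _:-_; :-_)
  open FieldProperties FF using (^-nonzero; *⁻¹-cancelʳ)
  open Conjugation FF p-prime card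
  open FiniteField FF card using (leftInverse⇒rightInverse)

  m : ℕ
  m = suc m′

  open Theorem3Data F FF p m b α β using (Δ; γ; ε; d; δ; f; h)

  ᾱ β̄ : Carrier
  ᾱ = conj α
  β̄ = conj β

  u : Carrier → Carrier
  u x = x ^ p - b * x

  K N : Carrier
  K = β̄ - α * d
  N = - (γ * d) - ε

  d≈[-conj[b]]^m : d ≈ (- conj b) ^ m
  d≈[-conj[b]]^m = begin
    (- 1#) ^ m * b ^ (m ℕ.* p)   ≈⟨ *-congˡ (^-congʳ b (ℕₚ.*-comm m p)) ⟩
    (- 1#) ^ m * b ^ (p ℕ.* m)   ≈⟨ *-congˡ (^-assocʳ b p m) ⟨
    (- 1#) ^ m * conj b ^ m      ≈⟨ ^-distrib-* (- 1#) (conj b) m ⟨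
    (- 1# * conj b) ^ m          ≈⟨ ^-congˡ m (-1*x≈-x (conj b)) ⟩
    (- conj b) ^ m               ∎

  f-cong : ∀ {x y} → x ≈ y → f x ≈ f y
  f-cong x≈y = +-cong (+-cong (^-congˡ m (+-cong (conj-cong x≈y) (-‿cong (*-congˡ x≈y))))
                              (*-congˡ (conj-cong x≈y)))
                      (*-congˡ x≈y)

  h-cong : ∀ {x y} → x ≈ y → h x ≈ h y
  h-cong x≈y = +-cong (+-cong (*-congˡ (^-congˡ m (+-cong (conj-cong x≈y) (-‿cong (*-congˡ x≈y)))))
                              (*-congˡ (conj-cong x≈y)))
                      (*-congˡ x≈y)

  module _ (b^[p+1]≈1 : b ^ (p ℕ.+ 1) ≈ 1#)
           (α^[p+1]≉β^[p+1] : ¬ α ^ (p ℕ.+ 1) ≈ β ^ (p ℕ.+ 1))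
           (hyp : (β + b * α) ^ (p ∸ 1) ≈ (- 1#) ^ m * b ^ (m ℕ.* p ∸ 1)) where

    conj[b]*b≈1 : conj b * b ≈ 1#
    conj[b]*b≈1 = trans (sym (x^[p+1]≈conj[x]*x b)) b^[p+1]≈1

    conj-u : ∀ x → conj (u x) ≈ - conj b * u x
    conj-u x = begin
      conj (x ^ p - b * x)                  ≈⟨ conj-homo-‿- (x ^ p) (b * x) ⟩
      conj (conj x) - conj (b * x)          ≈⟨ +-cong (conj-involutive x) (-‿cong (conj-homo-* b x)) ⟩
      x - conj b * conj x                   ≈⟨ +-congʳ (trans (*-congʳ conj[b]*b≈1) (*-identityˡ x)) ⟨
      (conj b * b) * x - conj b * conj x
        ≈⟨ solve 4 (λ b̄ x̄ b x → (b̄ :* b) :* x :- b̄ :* x̄ := :- b̄ :* (x̄ :- b :* x)) refl (conj b) (conj x) b x ⟩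
      - conj b * (conj x - b * x)           ∎

    conj-u^m : ∀ x → conj (u x ^ m) ≈ d * u x ^ m
    conj-u^m x = begin
      conj (u x ^ m)          ≈⟨ conj-homo-^ (u x) m ⟩
      conj (u x) ^ m          ≈⟨ ^-congˡ m (conj-u x) ⟩
      (- conj b * u x) ^ m    ≈⟨ ^-distrib-* (- conj b) (u x) m ⟩
      (- conj b) ^ m * u x ^ m ≈⟨ *-congʳ d≈[-conj[b]]^m ⟨
      d * u x ^ m             ∎

    conj-f : ∀ x → conj (f x) ≈ (d * u x ^ m + ᾱ * x) + β̄ * conj x
    conj-f x = begin
      conj ((u x ^ m + α * conj x) + β * x)               ≈⟨ conj-homo-+ _ _ ⟩
      conj (u x ^ m + α * conj x) + conj (β * x)          ≈⟨ +-cong (conj-homo-+ _ _) (conj-homo-* β x) ⟩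
      (conj (u x ^ m) + conj (α * conj x)) + β̄ * conj x
        ≈⟨ +-congʳ (+-cong (conj-u^m x) (trans (conj-homo-* α (conj x)) (*-congˡ (conj-involutive x)))) ⟩
      (d * u x ^ m + ᾱ * x) + β̄ * conj x                  ∎

    -- conj s unfolds to s * s ^ (p ∸ 1), which hyp evaluates for s = β + b α.
    b*β̄+ᾱ≈d*[β+b*α] : b * β̄ + ᾱ ≈ d * (β + b * α)
    b*β̄+ᾱ≈d*[β+b*α] = begin
      b * β̄ + ᾱ                       ≈⟨ +-congˡ (trans (*-congʳ conj[b]*b≈1) (*-identityˡ ᾱ)) ⟨
      b * β̄ + (conj b * b) * ᾱ
        ≈⟨ solve 4 (λ b β̄ b̄ ᾱ → b :* β̄ :+ (b̄ :* b) :* ᾱ := b :* (β̄ :+ b̄ :* ᾱ)) refl b β̄ (conj b) ᾱ ⟩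
      b * (β̄ + conj b * ᾱ)            ≈⟨ *-congˡ (trans (conj-homo-+ β (b * α)) (+-congˡ (conj-homo-* b α))) ⟨
      b * conj (β + b * α)            ≈⟨ *-congˡ (*-congˡ hyp) ⟩
      b * ((β + b * α) * ((- 1#) ^ m * b′))
        ≈⟨ solve 4 (λ b s σ b′ → b :* (s :* (σ :* b′)) := (σ :* (b :* b′)) :* s) refl b (β + b * α) ((- 1#) ^ m) b′ ⟩
      d * (β + b * α)                 ∎
      where
      b′ : Carrier
      b′ = b ^ (m ℕ.* p ∸ 1)

    conj[f]-d*f≈K*u : ∀ x → conj (f x) - d * f x ≈ K * u x
    conj[f]-d*f≈K*u x = begin
      conj (f x) - d * f x
        ≈⟨ +-congʳ (conj-f x) ⟩
      ((d * U + ᾱ * x) + β̄ * x̄) - d * ((U + α * x̄) + β * x)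
        ≈⟨ solve 9 (λ d U ᾱ β̄ x̄ α β b x →
                      ((d :* U :+ ᾱ :* x) :+ β̄ :* x̄) :- d :* ((U :+ α :* x̄) :+ β :* x)
                      := (β̄ :- α :* d) :* (x̄ :- b :* x) :+ ((b :* β̄ :+ ᾱ) :- d :* (β :+ b :* α)) :* x)
                   refl d U ᾱ β̄ x̄ α β b x ⟩
      K * u x + ((b * β̄ + ᾱ) - d * (β + b * α)) * x
        ≈⟨ +-congˡ (*-congʳ (x≈y⇒x∙y⁻¹≈ε b*β̄+ᾱ≈d*[β+b*α])) ⟩
      K * u x + 0# * x                  ≈⟨ +-congˡ (zeroˡ x) ⟩
      K * u x + 0#                      ≈⟨ +-identityʳ _ ⟩
      K * u x                           ∎
      where
      U x̄ : Carrier
      U = u x ^ m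
      x̄ = conj x

    K≉0 : ¬ K ≈ 0#
    K≉0 K≈0 = α^[p+1]≉β^[p+1] (begin
      α ^ (p ℕ.+ 1) ≈⟨ x^[p+1]≈conj[x]*x α ⟩
      ᾱ * α         ≈⟨ *-congʳ ᾱ≈d*β ⟩
      (d * β) * α   ≈⟨ solve 3 (λ d β α → (d :* β) :* α := (α :* d) :* β) refl d β α ⟩
      (α * d) * β   ≈⟨ *-congʳ β̄≈α*d ⟨
      β̄ * β         ≈⟨ x^[p+1]≈conj[x]*x β ⟨
      β ^ (p ℕ.+ 1) ∎)
      where
      β̄≈α*d : β̄ ≈ α * d
      β̄≈α*d = x∙y⁻¹≈ε⇒x≈y β̄ (α * d) K≈0

      ᾱ≈d*β : ᾱ ≈ d * β
      ᾱ≈d*β = ∙-cancelˡ (b * β̄) ᾱ (d * β) (begin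
        b * β̄ + ᾱ           ≈⟨ b*β̄+ᾱ≈d*[β+b*α] ⟩
        d * (β + b * α)     ≈⟨ solve 4 (λ d β b α → d :* (β :+ b :* α) := b :* (α :* d) :+ d :* β) refl d β b α ⟩
        b * (α * d) + d * β ≈⟨ +-congʳ (*-congˡ β̄≈α*d) ⟨
        b * β̄ + d * β       ∎)

    Δ≈β̄*β-ᾱ*α : Δ ≈ β̄ * β - ᾱ * α
    Δ≈β̄*β-ᾱ*α = +-cong (x^[p+1]≈conj[x]*x β) (-‿cong (x^[p+1]≈conj[x]*x α))

    Δ≉0 : ¬ Δ ≈ 0#
    Δ≉0 Δ≈0 = α^[p+1]≉β^[p+1] (sym (x∙y⁻¹≈ε⇒x≈y _ _ Δ≈0))

    γ*ᾱ+ε*β≈1 : γ * ᾱ + ε * β ≈ 1#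
    γ*ᾱ+ε*β≈1 = begin
      ((- α) * Δ ⁻¹) * ᾱ + (β̄ * Δ ⁻¹) * β
        ≈⟨ solve 5 (λ α Δ⁻¹ ᾱ β̄ β → (:- α :* Δ⁻¹) :* ᾱ :+ (β̄ :* Δ⁻¹) :* β := (β̄ :* β :- ᾱ :* α) :* Δ⁻¹)
                   refl α (Δ ⁻¹) ᾱ β̄ β ⟩
      (β̄ * β - ᾱ * α) * Δ ⁻¹     ≈⟨ *-congʳ Δ≈β̄*β-ᾱ*α ⟨
      Δ * Δ ⁻¹                   ≈⟨ *-inverse Δ Δ≉0 ⟩
      1#                         ∎

    γ*β̄+ε*α≈0 : γ * β̄ + ε * α ≈ 0#
    γ*β̄+ε*α≈0 = begin
      ((- α) * Δ ⁻¹) * β̄ + (β̄ * Δ ⁻¹) * α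
        ≈⟨ solve 3 (λ α Δ⁻¹ β̄ → (:- α :* Δ⁻¹) :* β̄ :+ (β̄ :* Δ⁻¹) :* α := :- (β̄ :* Δ⁻¹ :* α) :+ β̄ :* Δ⁻¹ :* α)
                   refl α (Δ ⁻¹) β̄ ⟩
      - (β̄ * Δ ⁻¹ * α) + β̄ * Δ ⁻¹ * α ≈⟨ -‿inverseˡ _ ⟩
      0#                              ∎

    δ*K^m≈N : δ * K ^ m ≈ N
    δ*K^m≈N = *⁻¹-cancelʳ N (^-nonzero m K≉0)

    h∘f≈id : ∀ x → h (f x) ≈ x
    h∘f≈id x = begin
      (δ * (conj (f x) - d * f x) ^ m + γ * conj (f x)) + ε * f x
        ≈⟨ +-congʳ (+-cong (*-congˡ (^-congˡ m (conj[f]-d*f≈K*u x))) (*-congˡ (conj-f x))) ⟩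
      (δ * (K * u x) ^ m + γ * conj[f]) + ε * f x
        ≈⟨ +-congʳ (+-congʳ (*-congˡ (^-distrib-* K (u x) m))) ⟩
      (δ * (K ^ m * U) + γ * conj[f]) + ε * f x
        ≈⟨ +-congʳ (+-congʳ (trans (sym (*-assoc δ (K ^ m) U)) (*-congʳ δ*K^m≈N))) ⟩
      (N * U + γ * conj[f]) + ε * f x
        ≈⟨ solve 10 (λ γ d ε U ᾱ x β̄ x̄ α β →
                       (((:- (γ :* d)) :- ε) :* U :+ γ :* ((d :* U :+ ᾱ :* x) :+ β̄ :* x̄)) :+ ε :* ((U :+ α :* x̄) :+ β :* x)
                       := (γ :* ᾱ :+ ε :* β) :* x :+ (γ :* β̄ :+ ε :* α) :* x̄)
                    refl γ d ε U ᾱ x β̄ x̄ α β ⟩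
      (γ * ᾱ + ε * β) * x + (γ * β̄ + ε * α) * x̄
        ≈⟨ +-cong (*-congʳ γ*ᾱ+ε*β≈1) (*-congʳ γ*β̄+ε*α≈0) ⟩
      1# * x + 0# * x̄                 ≈⟨ +-cong (*-identityˡ x) (zeroˡ x̄) ⟩
      x + 0#                          ≈⟨ +-identityʳ x ⟩
      x                               ∎
      where
      U x̄ conj[f] : Carrier
      U = u x ^ m
      x̄ = conj x
      conj[f] = (d * U + ᾱ * x) + β̄ * x̄

    f∘h≈id : ∀ x → f (h x) ≈ x
    f∘h≈id = leftInverse⇒rightInverse f-cong h-cong h∘f≈id

-- Imported only here, since above _×_ is the ring's ℕ-multiple.
open import Data.Product using (_×_)

theorem3 : ∀ {c ℓ} (F : CommutativeRing c ℓ) (FF : IsField F) (p : ℕ) → Prime p →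
  HasCardinality F (p ℕ.* p) →
  (m : ℕ) → 2 ≤ m → m ≤ p ℕ.∸ 1 →
  (b α β : CommutativeRing.Carrier F) →
  let open CommutativeRing F
      open Theorem3Data F FF p m b α β
  in b ^ (p ℕ.+ 1) ≈ 1# →
     ¬ (α ≈ 0#) → ¬ (β ≈ 0#) →
     ¬ (α ^ (p ℕ.+ 1) ≈ β ^ (p ℕ.+ 1)) →
     (β + b * α) ^ (p ℕ.∸ 1) ≈ ((- 1#) ^ m) * (b ^ (m ℕ.* p ℕ.∸ 1)) →
     (∀ x → h (f x) ≈ x) × (∀ x → f (h x) ≈ x)
theorem3 F FF (suc n) p-prime card (suc m′) _ _ b α β b^[p+1]≈1 _ _ α^[p+1]≉β^[p+1] hyp =
  h∘f≈id b^[p+1]≈1 α^[p+1]≉β^[p+1] hyp , f∘h≈id b^[p+1]≈1 α^[p+1]≉β^[p+1] hyp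
  where open Theorem3Proof FF p-prime card m′ b α β
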